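{- For all $m,n\ge1$, $\vec s\in\mathbb Z^m$ and $\vec t\in\mathbb Z^n$, $$J([\vec s]\sqcup\!\sqcup[\vec t])=J([\vec s])\sqcup\!\sqcup[\vec t]+[\vec s]\sqcup\!\sqcup J([\vec t]).$$ Consequently, since $J(\mathbf 1)=0$, $J$ is a differential operator (derivation) on $(\mathcal H_{\mathbb Z},\sqcup\!\sqcup)$.
   Context: Let $\mathcal H_{\mathbb Z}$ be the $\mathbb Q$-vector space with basis $\mathbf 1$ together with the formal symbols $[s_1,\dots,s_k]$ for $k\ge1$ and $(s_1,\dots,s_k)\in\mathbb Z^k$. Define linear maps on basis elements of positive depth by $I([s_1,s_2,\dots,s_k])=[s_1+1,s_2,\dots,s_k]$ and $J([s_1,s_2,\dots,s_k])=[s_1-1,s_2,\dots,s_k]$, and set $J(\mathbf 1)=0$. Notation: for a positive-depth basis element, write $[s_1,\dots,s_k]=[s_1,\vec s\,']$, where $[\vec s\,']=[s_2,\dots,s_k]$, or $\mathbf 1$ if $k=1$. For $a\in\mathbb Z$ and $X=\sum c_{\vec v}[\vec v]$, put $[a,X]:=\sum c_{\vec v}[a,\vec v]$, with $[a,\mathbf 1]:=[a]$. The extended shuffle product $\sqcup\!\sqcup$ is the bilinear product with two-sided unit $\mathbf 1$, defined on positive-depth basis elements by the following recursions: <ul> <li>(i) if $s_1=0$: $[0,\vec s\,']\sqcup\!\sqcup[t_1,\vec t\,']=[0,[\vec s\,']\sqcup\!\sqcup[t_1,\vec t\,']]$;</li> <li>(ii) if $s_1>0$ and $t_1=0$: $[s_1,\vec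 s\,']\sqcup\!\sqcup[0,\vec t\,']=[0,[s_1,\vec s\,']\sqcup\!\sqcup[\vec t\,']]$;</li> <li>(iii) if $s_1,t_1>0$: $[s_1,\vec s\,']\sqcup\!\sqcup[t_1,\vec t\,']=I([s_1,\vec s\,']\sqcup\!\sqcup[t_1-1,\vec t\,'])+I([s_1-1,\vec s\,']\sqcup\!\sqcup[t_1,\vec t\,'])$;</li> <li>(iv) if $s_1>0$ and $t_1<0$: $[s_1,\vec s\,']\sqcup\!\sqcup[t_1,\vec t\,']=J([s_1,\vec s\,']\sqcup\!\sqcup[t_1+1,\vec t\,'])-[s_1-1,\vec s\,']\sqcup\!\sqcup[t_1+1,\vec t\,']$;</li> <li>(v) if $s_1<0$: $[s_1,\vec s\,']\sqcup\!\sqcup[t_1,\vec t\,']=J([s_1+1,\vec s\,']\sqcup\!\sqcup[t_1,\vec t\,'])-[s_1+1,\vec s\,']\sqcup\!\sqcup[t_1-1,\vec t\,']$.</li> </ul> The recursions are well founded: (i) and (ii) by induction on total depth, (iii) on $s_1+t_1$, (iv) on $|t_1|$, and (v) on $|s_1|$. -}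

module Defs where

open import Data.Nat using (ℕ; zero; suc) renaming (_+_ to _+ℕ_)
open import Data.Integer using (ℤ; +_; -[1+_]) renaming (_+_ to _+ℤ_; _-_ to _-ℤ_)
import Data.Integer as ℤ
open import Data.Rational using (ℚ; 0ℚ; 1ℚ) renaming (_+_ to _+ℚ_; _*_ to _*ℚ_; -_ to -ℚ_)
open import Data.List using (List; []; _∷_; map; concatMap; length; _++_)
import Data.List.Properties as LP
open import Data.Product using (_×_; _,_)
open import Relation.Binary.PropositionalEquality using (_≡_)
open import Relation.Nullary using (yes; no)

-- Words: the basis of H_Z.  The empty list [] is the unit 𝟏, and
-- (s₁ ∷ … ∷ s_k ∷ []) is the symbol [s₁,…,s_k].

Word : Set
Word = List ℤ

-- Elements of H_Z: finite formal ℚ-linear combinations of words,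
-- represented as lists of (coefficient , word); equality is the
-- equality of coefficient functions (_≈_ below).

H : Set
H = List (ℚ × Word)

word : Word → H
word w = (1ℚ , w) ∷ []

𝟏 : H
𝟏 = word []

0H : H
0H = []

infixl 6 _⊕_ _⊖_
_⊕_ : H → H → H
X ⊕ Y = X ++ Y

scale : ℚ → H → H
scale c = map (λ { (d , w) → (c *ℚ d , w) })

_⊖_ : H → H → H
X ⊖ Y = X ++ scale (-ℚ 1ℚ) Y

coeff : H → Word → ℚ
coeff [] w = 0ℚ
coeff ((c , v) ∷ X) w with LP.≡-dec ℤ._≟_ v w
... | yes _ = c +ℚ coeff X w
... | no  _ = coeff X w

infix 4 _≈_
_≈_ : H → H → Set
X ≈ Y = ∀ w → coeff X w ≡ coeff Y w

prefix : ℤ → H → H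
prefix a = map (λ { (c , w) → (c , a ∷ w) })

-- I and J on basis words (extended linearly).
-- I is only defined on positive depth in the paper; here I(𝟏) := 0,
-- a case that never arises in the recursions.  J(𝟏) = 0 as in the paper.
Iw : Word → H
Iw [] = 0H
Iw (s ∷ w) = word (ℤ.suc s ∷ w)

Jw : Word → H
Jw [] = 0H
Jw (s ∷ w) = word (ℤ.pred s ∷ w)

linear : (Word → H) → H → H
linear f = concatMap (λ { (c , w) → scale c (f w) })

I : H → H
I = linear Iw

J : H → H
J = linear Jw

-- The extended shuffle product on basis words of positive depth with
-- fixed tails s' , t' : given `rec`, the shuffle product on total depth
-- strictly smaller, `core x y` computes [x , s'] ⧢ [y , t'].

module Core (rec : Word → Word → H) (s' t' : Word) where

  -- case (i):  [0,s'] ⧢ [y,t'] = [0, [s'] ⧢ [y,t']]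
  c1 : ℤ → H
  c1 y = prefix (+ 0) (rec s' (y ∷ t'))

  -- case (ii): [x,s'] ⧢ [0,t'] = [0, [x,s'] ⧢ [t']]   (x > 0)
  c2 : ℕ → H
  c2 a = prefix (+ 0) (rec (+ a ∷ s') t')

  -- Q a b = [a,s'] ⧢ [b,t']  for a , b ≥ 0  (cases (i),(ii),(iii))
  Q : ℕ → ℕ → H
  Q zero b = c1 (+ b)
  Q (suc a) zero = c2 (suc a)
  Q (suc a) (suc b) = I (Q (suc a) b) ⊕ I (Q a (suc b))

  -- N a b = [a,s'] ⧢ [-(b+1),t']  for a ≥ 0  (cases (i),(iv))
  N : ℕ → ℕ → H
  N zero b = c1 -[1+ b ]
  N (suc a) zero = J (Q (suc a) 0) ⊖ Q a 0
  N (suc a) (suc b) = J (N (suc a) b) ⊖ N a b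

  -- M a y = [-(a+1),s'] ⧢ [y,t']  (case (v))
  M : ℕ → ℤ → H
  M zero y = J (c1 y) ⊖ c1 (y -ℤ + 1)
  M (suc a) y = J (M a y) ⊖ M a (y -ℤ + 1)

  core : ℤ → ℤ → H
  core (+ a) (+ b) = Q a b
  core (+ a) -[1+ b ] = N a b
  core -[1+ a ] y = M a y

-- shN n s t : the shuffle product where n is the total depth
-- length s + length t (recursion on total depth).
shN : ℕ → Word → Word → H
shN n [] t = word t
shN n (x ∷ s') [] = word (x ∷ s')
shN zero (x ∷ s') (y ∷ t') = 0H   -- unreachable: depth ≥ 2
shN (suc n) (x ∷ s') (y ∷ t') = Core.core (shN n) s' t' x y

shw : Word → Word → H
shw s t = shN (length s +ℕ length t) s t

infixl 7 _⧢_
_⧢_ : H → H → H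
X ⧢ Y = concatMap (λ { (c , u) → concatMap (λ { (d , v) → scale (c *ℚ d) (shw u v) }) Y }) X

{-# OPTIONS --safe #-}
-- Elements of H are tested against arbitrary functions g on words through the pairing
-- pair X g = Σ c·g(w); under it J and I become precomposition with transposes Jᵀ, Iᵀ, and
-- X ⧢ Y a double sum over the words of X and Y.  So it suffices to show, for basis words,
-- J([s₁,s'] ⧢ [t₁,t']) = [s₁-1,s'] ⧢ [t₁,t'] + [s₁,s'] ⧢ [t₁-1,t'].  For s₁ ≤ 0 this is
-- recursion (v) at s₁-1 read backwards, and for s₁ > 0 ≥ t₁ it is (iv) at t₁-1.  For
-- s₁, t₁ > 0, (iii) writes the product as I(…) + I(…), and J undoes I on combinations of
-- positive depth.
module Submission where

open import Defs
open import Data.Integer using (ℤ; +_; -[1+_]; pred; -1ℤ) renaming (suc to sucℤ)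
import Data.Integer.Properties as ℤ
open import Data.Nat using (zero; suc)
open import Data.List using (List; []; _∷_; _++_; concatMap)
import Data.List.Properties as List
open import Data.Product using (_×_; _,_)
open import Data.Rational using (ℚ; 0ℚ; 1ℚ; _+_; _*_; -_; _-_)
open import Data.Rational.Properties
  using (+-comm; +-identityˡ; +-identityʳ; *-identityˡ; *-identityʳ; *-zeroʳ; *-assoc; *-distribˡ-+;
         neg-distribˡ-*)
open import Data.Rational.Solver using (module +-*-Solver)
open import Relation.Binary.PropositionalEquality
  using (_≡_; _≗_; refl; sym; trans; cong; cong₂; module ≡-Reasoning)
open import Relation.Nullary using (yes; no)

open +-*-Solver using (solve; _:+_; _:-_; _:*_; _:=_)
open ≡-Reasoning

pair : H → (Word → ℚ) → ℚ
pair [] g = 0ℚ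
pair ((c , u) ∷ X) g = c * g u + pair X g

infix 4 _∼_
_∼_ : H → H → Set
X ∼ Y = ∀ g → pair X g ≡ pair Y g

pair-cong : ∀ X {g h : Word → ℚ} → g ≗ h → pair X g ≡ pair X h
pair-cong [] g≗h = refl
pair-cong ((c , u) ∷ X) g≗h = cong₂ (λ a b → c * a + b) (g≗h u) (pair-cong X g≗h)

pair-0ʳ : ∀ X → pair X (λ _ → 0ℚ) ≡ 0ℚ
pair-0ʳ [] = refl
pair-0ʳ ((c , u) ∷ X) = trans (cong₂ _+_ (*-zeroʳ c) (pair-0ʳ X)) (+-identityʳ 0ℚ)

pair-+ʳ : ∀ X (g h : Word → ℚ) → pair X (λ u → g u + h u) ≡ pair X g + pair X h
pair-+ʳ [] g h = sym (+-identityʳ 0ℚ)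
pair-+ʳ ((c , u) ∷ X) g h = begin
  c * (g u + h u) + pair X (λ u → g u + h u)
    ≡⟨ cong₂ _+_ (*-distribˡ-+ c (g u) (h u)) (pair-+ʳ X g h) ⟩
  (c * g u + c * h u) + (pair X g + pair X h)
    ≡⟨ solve 4 (λ a b x y → (a :+ b) :+ (x :+ y) := (a :+ x) :+ (b :+ y)) refl
               (c * g u) (c * h u) (pair X g) (pair X h) ⟩
  (c * g u + pair X g) + (c * h u + pair X h) ∎

pair-*ʳ : ∀ X c (g : Word → ℚ) → pair X (λ u → c * g u) ≡ c * pair X g
pair-*ʳ [] c g = sym (*-zeroʳ c)
pair-*ʳ ((d , u) ∷ X) c g = begin
  d * (c * g u) + pair X (λ u → c * g u)
    ≡⟨ cong₂ _+_ (solve 3 (λ d c x → d :* (c :* x) := c :* (d :* x)) refl d c (g u)) (pair-*ʳ X c g) ⟩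
  c * (d * g u) + c * pair X g ≡⟨ sym (*-distribˡ-+ c (d * g u) (pair X g)) ⟩
  c * (d * g u + pair X g)     ∎

pair-++ : ∀ X Y g → pair (X ++ Y) g ≡ pair X g + pair Y g
pair-++ [] Y g = sym (+-identityˡ (pair Y g))
pair-++ ((c , u) ∷ X) Y g =
  trans (cong (_+_ (c * g u)) (pair-++ X Y g))
        (solve 3 (λ a x y → a :+ (x :+ y) := (a :+ x) :+ y) refl (c * g u) (pair X g) (pair Y g))

pair-scale : ∀ c X g → pair (scale c X) g ≡ c * pair X g
pair-scale c [] g = sym (*-zeroʳ c)
pair-scale c ((d , u) ∷ X) g = begin
  c * d * g u + pair (scale c X) g ≡⟨ cong₂ _+_ (*-assoc c d (g u)) (pair-scale c X g) ⟩
  c * (d * g u) + c * pair X g     ≡⟨ sym (*-distribˡ-+ c (d * g u) (pair X g)) ⟩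
  c * (d * g u + pair X g)         ∎

pair-⊖ : ∀ X Y g → pair (X ⊖ Y) g ≡ pair X g - pair Y g
pair-⊖ X Y g = begin
  pair (X ⊖ Y) g                     ≡⟨ pair-++ X (scale (- 1ℚ) Y) g ⟩
  pair X g + pair (scale (- 1ℚ) Y) g ≡⟨ cong (_+_ (pair X g)) (pair-scale (- 1ℚ) Y g) ⟩
  pair X g + - 1ℚ * pair Y g         ≡⟨ cong (_+_ (pair X g)) (sym (neg-distribˡ-* 1ℚ (pair Y g))) ⟩
  pair X g + - (1ℚ * pair Y g)       ≡⟨ cong (λ a → pair X g + - a) (*-identityˡ (pair Y g)) ⟩
  pair X g - pair Y g                ∎

pair-word : ∀ u g → pair (word u) g ≡ g u
pair-word u g = trans (+-identityʳ (1ℚ * g u)) (*-identityˡ (g u))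

pair-prefix : ∀ a X g → pair (prefix a X) g ≡ pair X (λ w → g (a ∷ w))
pair-prefix a [] g = refl
pair-prefix a ((c , w) ∷ X) g = cong (_+_ (c * g (a ∷ w))) (pair-prefix a X g)

pair-concatMap : ∀ {F : ℚ × Word → H} {g} (h : Word → ℚ) →
                 (∀ c u → pair (F (c , u)) g ≡ c * h u) →
                 ∀ X → pair (concatMap F X) g ≡ pair X h
pair-concatMap h piece [] = refl
pair-concatMap {F} {g} h piece ((c , u) ∷ X) =
  trans (pair-++ (F (c , u)) (concatMap F X) g) (cong₂ _+_ (piece c u) (pair-concatMap h piece X))

pair-linear : ∀ f X g → pair (linear f X) g ≡ pair X (λ u → pair (f u) g)
pair-linear f X g = pair-concatMap _ (λ c u → pair-scale c (f u) g) X

Iᵀ Jᵀ : (Word → ℚ) → Word → ℚ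
Iᵀ g [] = 0ℚ
Iᵀ g (s ∷ w) = g (sucℤ s ∷ w)
Jᵀ g [] = 0ℚ
Jᵀ g (s ∷ w) = g (pred s ∷ w)

pair-I : ∀ X g → pair (I X) g ≡ pair X (Iᵀ g)
pair-I X g = trans (pair-linear Iw X g) (pair-cong X Iw-transpose)
  where
  Iw-transpose : ∀ u → pair (Iw u) g ≡ Iᵀ g u
  Iw-transpose [] = refl
  Iw-transpose (s ∷ w) = pair-word (sucℤ s ∷ w) g

pair-J : ∀ X g → pair (J X) g ≡ pair X (Jᵀ g)
pair-J X g = trans (pair-linear Jw X g) (pair-cong X Jw-transpose)
  where
  Jw-transpose : ∀ u → pair (Jw u) g ≡ Jᵀ g u
  Jw-transpose [] = refl
  Jw-transpose (s ∷ w) = pair-word (pred s ∷ w) g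

pair-⧢ : ∀ X Y g → pair (X ⧢ Y) g ≡ pair X (λ u → pair Y (λ v → pair (shw u v) g))
pair-⧢ X Y g = pair-concatMap _ row X
  where
  row : ∀ c u → pair (concatMap (λ { (d , v) → scale (c * d) (shw u v) }) Y) g
                  ≡ c * pair Y (λ v → pair (shw u v) g)
  row c u = trans (pair-concatMap (λ v → c * pair (shw u v) g) entry Y) (pair-*ʳ Y c _)
    where
    entry : ∀ d v → pair (scale (c * d) (shw u v)) g ≡ d * (c * pair (shw u v) g)
    entry d v = trans (pair-scale (c * d) (shw u v) g)
                      (solve 3 (λ c d x → c :* d :* x := d :* (c :* x)) refl c d (pair (shw u v) g))

coeff-pair : ∀ X w → coeff X w ≡ pair X (λ v → coeff (word v) w)
coeff-pair [] w = refl
coeff-pair ((c , v) ∷ X) w with List.≡-dec ℤ._≟_ v w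
... | yes _ = cong₂ _+_ (sym (trans (cong (c *_) (+-identityʳ 1ℚ)) (*-identityʳ c))) (coeff-pair X w)
... | no  _ = trans (coeff-pair X w) (sym (trans (cong (_+ pair X _) (*-zeroʳ c)) (+-identityˡ _)))

∼⇒≈ : ∀ {X Y} → X ∼ Y → X ≈ Y
∼⇒≈ {X} {Y} X∼Y w = trans (coeff-pair X w) (trans (X∼Y _) (sym (coeff-pair Y w)))

withoutUnit : (Word → ℚ) → Word → ℚ
withoutUnit g [] = 0ℚ
withoutUnit g (s ∷ w) = g (s ∷ w)

PositiveDepth : H → Set
PositiveDepth X = ∀ g → pair X (withoutUnit g) ≡ pair X g

prefix-positiveDepth : ∀ a X → PositiveDepth (prefix a X)
prefix-positiveDepth a X g = trans (pair-prefix a X (withoutUnit g)) (sym (pair-prefix a X g))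

I-positiveDepth : ∀ X → PositiveDepth (I X)
I-positiveDepth X g =
  trans (pair-I X (withoutUnit g)) (trans (pair-cong X Iᵀ-withoutUnit) (sym (pair-I X g)))
  where
  Iᵀ-withoutUnit : ∀ u → Iᵀ (withoutUnit g) u ≡ Iᵀ g u
  Iᵀ-withoutUnit [] = refl
  Iᵀ-withoutUnit (s ∷ w) = refl

⊕-positiveDepth : ∀ X Y → PositiveDepth X → PositiveDepth Y → PositiveDepth (X ⊕ Y)
⊕-positiveDepth X Y pX pY g =
  trans (pair-++ X Y (withoutUnit g)) (trans (cong₂ _+_ (pX g) (pY g)) (sym (pair-++ X Y g)))

J-I : ∀ X → PositiveDepth X → J (I X) ∼ X
J-I X pX g = begin
  pair (J (I X)) g        ≡⟨ pair-J (I X) g ⟩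
  pair (I X) (Jᵀ g)       ≡⟨ pair-I X (Jᵀ g) ⟩
  pair X (Iᵀ (Jᵀ g))      ≡⟨ pair-cong X Iᵀ-Jᵀ ⟩
  pair X (withoutUnit g)  ≡⟨ pX g ⟩
  pair X g                ∎
  where
  Iᵀ-Jᵀ : ∀ u → Iᵀ (Jᵀ g) u ≡ withoutUnit g u
  Iᵀ-Jᵀ [] = refl
  Iᵀ-Jᵀ (s ∷ w) = cong (λ r → g (r ∷ w)) (ℤ.pred-suc s)

⊖-⊕-cancel : ∀ A B → A ∼ (A ⊖ B) ⊕ B
⊖-⊕-cancel A B g = begin
  pair A g                         ≡⟨ solve 2 (λ a b → a := (a :- b) :+ b) refl (pair A g) (pair B g) ⟩
  (pair A g - pair B g) + pair B g ≡⟨ cong (_+ pair B g) (sym (pair-⊖ A B g)) ⟩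
  pair (A ⊖ B) g + pair B g        ≡⟨ sym (pair-++ (A ⊖ B) B g) ⟩
  pair ((A ⊖ B) ⊕ B) g             ∎

⊕-⊖-cancel : ∀ A B → A ∼ B ⊕ (A ⊖ B)
⊕-⊖-cancel A B g = begin
  pair A g                         ≡⟨ solve 2 (λ a b → a := b :+ (a :- b)) refl (pair A g) (pair B g) ⟩
  pair B g + (pair A g - pair B g) ≡⟨ cong (_+_ (pair B g)) (sym (pair-⊖ A B g)) ⟩
  pair B g + pair (A ⊖ B) g        ≡⟨ sym (pair-++ B (A ⊖ B) g) ⟩
  pair (B ⊕ (A ⊖ B)) g             ∎

module _ (rec : Word → Word → H) (s' t' : Word) where
  open Core rec s' t'

  Q-positiveDepth : ∀ a b → PositiveDepth (Q a b)
  Q-positiveDepth zero b = prefix-positiveDepth (+ 0) (rec s' (+ b ∷ t'))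
  Q-positiveDepth (suc a) zero = prefix-positiveDepth (+ 0) (rec (+ suc a ∷ s') t')
  Q-positiveDepth (suc a) (suc b) = ⊕-positiveDepth (I (Q (suc a) b)) (I (Q a (suc b)))
                                      (I-positiveDepth (Q (suc a) b)) (I-positiveDepth (Q a (suc b)))

  core-zeroˡ : ∀ y → core (+ 0) y ≡ c1 y
  core-zeroˡ (+ b) = refl
  core-zeroˡ -[1+ b ] = refl

  J-core : ∀ x y → J (core x y) ∼ core (pred x) y ⊕ core x (pred y)
  J-core (+ zero) y rewrite core-zeroˡ y | core-zeroˡ (pred y) | ℤ.+-comm y -1ℤ =
    ⊖-⊕-cancel (J (c1 y)) (c1 (pred y))
  J-core -[1+ a ] y rewrite ℤ.+-comm y -1ℤ = ⊖-⊕-cancel (J (M a y)) (M a (pred y))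
  J-core (+ suc a) (+ zero) rewrite ℤ.pred-suc (+ a) = ⊕-⊖-cancel (J (Q (suc a) 0)) (Q a 0)
  J-core (+ suc a) -[1+ b ] rewrite ℤ.pred-suc (+ a) = ⊕-⊖-cancel (J (N (suc a) b)) (N a b)
  J-core (+ suc a) (+ suc b) rewrite ℤ.pred-suc (+ a) | ℤ.pred-suc (+ b) = λ g → begin
    pair (J (I A ⊕ I B)) g                ≡⟨ pair-J (I A ⊕ I B) g ⟩
    pair (I A ⊕ I B) (Jᵀ g)               ≡⟨ pair-++ (I A) (I B) (Jᵀ g) ⟩
    pair (I A) (Jᵀ g) + pair (I B) (Jᵀ g) ≡⟨ cong₂ _+_ (sym (pair-J (I A) g)) (sym (pair-J (I B) g)) ⟩
    pair (J (I A)) g + pair (J (I B)) g   ≡⟨ cong₂ _+_ (J-I A (Q-positiveDepth (suc a) b) g)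
                                                        (J-I B (Q-positiveDepth a (suc b)) g) ⟩
    pair A g + pair B g                   ≡⟨ +-comm (pair A g) (pair B g) ⟩
    pair B g + pair A g                   ≡⟨ sym (pair-++ B A g) ⟩
    pair (B ⊕ A) g                        ∎
    where
    A B : H
    A = Q (suc a) b
    B = Q a (suc b)

pair-J-word : ∀ u g → pair (J (word u)) g ≡ Jᵀ (λ v → pair (word v) g) u
pair-J-word [] g = refl
pair-J-word (s ∷ w) g =
  trans (pair-J (word (s ∷ w)) g) (trans (pair-word (s ∷ w) (Jᵀ g)) (sym (pair-word (pred s ∷ w) g)))

pair-J-shw : ∀ u v g → pair (J (shw u v)) g
                       ≡ Jᵀ (λ u′ → pair (shw u′ v) g) u + Jᵀ (λ v′ → pair (shw u v′) g) v
pair-J-shw [] v g = trans (pair-J-word v g) (sym (+-identityˡ _))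
pair-J-shw u@(_ ∷ _) [] g = trans (pair-J-word u g) (sym (+-identityʳ _))
pair-J-shw (x ∷ s') (y ∷ t') g =
  trans (J-core _ s' t' x y g) (pair-++ (shw (pred x ∷ s') (y ∷ t')) (shw (x ∷ s') (pred y ∷ t')) g)

Jᵀ-pair : ∀ Y (G : Word → Word → ℚ) u →
          Jᵀ (λ u′ → pair Y (G u′)) u ≡ pair Y (λ v → Jᵀ (λ u′ → G u′ v) u)
Jᵀ-pair Y G [] = sym (pair-0ʳ Y)
Jᵀ-pair Y G (s ∷ w) = refl

J-leibniz : ∀ X Y → J (X ⧢ Y) ∼ J X ⧢ Y ⊕ X ⧢ J Y
J-leibniz X Y g = begin
  pair (J (X ⧢ Y)) g                                  ≡⟨ pair-J (X ⧢ Y) g ⟩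
  pair (X ⧢ Y) (Jᵀ g)                                 ≡⟨ pair-⧢ X Y (Jᵀ g) ⟩
  pair X (λ u → pair Y (λ v → pair (shw u v) (Jᵀ g)))
    ≡⟨ pair-cong X (λ u → pair-cong Y (λ v → trans (sym (pair-J (shw u v) g)) (pair-J-shw u v g))) ⟩
  pair X (λ u → pair Y (λ v → L u v + R u v))         ≡⟨ pair-cong X (λ u → pair-+ʳ Y (L u) (R u)) ⟩
  pair X (λ u → pair Y (L u) + pair Y (R u))          ≡⟨ pair-+ʳ X _ _ ⟩
  pair X (λ u → pair Y (L u)) + pair X (λ u → pair Y (R u))
    ≡⟨ cong₂ _+_ (sym left) (sym right) ⟩
  pair (J X ⧢ Y) g + pair (X ⧢ J Y) g                 ≡⟨ sym (pair-++ (J X ⧢ Y) (X ⧢ J Y) g) ⟩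
  pair (J X ⧢ Y ⊕ X ⧢ J Y) g                          ∎
  where
  G L R : Word → Word → ℚ
  G u v = pair (shw u v) g
  L u v = Jᵀ (λ u′ → G u′ v) u
  R u v = Jᵀ (G u) v

  left : pair (J X ⧢ Y) g ≡ pair X (λ u → pair Y (L u))
  left = begin
    pair (J X ⧢ Y) g                       ≡⟨ pair-⧢ (J X) Y g ⟩
    pair (J X) (λ u → pair Y (G u))        ≡⟨ pair-J X _ ⟩
    pair X (Jᵀ (λ u → pair Y (G u)))       ≡⟨ pair-cong X (Jᵀ-pair Y G) ⟩
    pair X (λ u → pair Y (L u))            ∎

  right : pair (X ⧢ J Y) g ≡ pair X (λ u → pair Y (R u))
  right = trans (pair-⧢ X (J Y) g) (pair-cong X (λ u → pair-J Y (G u)))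

lemma2p12 : ((s₁ : ℤ) (s' : List ℤ) (t₁ : ℤ) (t' : List ℤ)
              → J (word (s₁ ∷ s') ⧢ word (t₁ ∷ t'))
                  ≈ J (word (s₁ ∷ s')) ⧢ word (t₁ ∷ t') ⊕ word (s₁ ∷ s') ⧢ J (word (t₁ ∷ t')))
            × ((X Y : H) → J (X ⧢ Y) ≈ J X ⧢ Y ⊕ X ⧢ J Y)
lemma2p12 = (λ s₁ s' t₁ t' → leibniz (word (s₁ ∷ s')) (word (t₁ ∷ t'))) , leibniz
  where
  leibniz : (X Y : H) → J (X ⧢ Y) ≈ J X ⧢ Y ⊕ X ⧢ J Y
  leibniz X Y = ∼⇒≈ {J (X ⧢ Y)} {J X ⧢ Y ⊕ X ⧢ J Y} (J-leibniz X Y)
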